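{- In the setting described in the context, for all integers $i\in\{2,\dots,\mathfrak m+1\}$, $j\in\{1,\dots,\mathfrak m-i+2\}$, $\xi\in\{\mathfrak m-j,\dots,\mathfrak m-1\}$, $\psi\in\{\xi+2,\dots,\mathfrak m+1\}$ we have $$\Big(\sum_{\beta=0}^{j+\xi-\mathfrak m}\ \sum_{\alpha=i+\beta}^{\mathfrak m+1-j+\beta} S_{i-1,i-2,\alpha,i-2+\beta}\,P_{\alpha,\mathfrak m-j+\beta,\psi,\xi}\Big)-S_{i-1,i-2,\psi,i-2+\xi+j-\mathfrak m}+P_{i-1,\mathfrak m-j,\psi,\xi}=0.$$
   Context: Let $\mathbb C_\infty$ be the completion of an algebraic closure of $\mathbb F_q((1/\theta))$. Let $V$ be an $n$-dimensional $\mathbb C_\infty$-vector space, $N$ a nilpotent $\mathbb C_\infty$-linear operator on $V$, and $\mathfrak m\ge1$ with $N^{\mathfrak m}=0$. Let $k_1,\dots,k_{\mathfrak m+1}\ge0$ be integers with sum $r$, and let $l_{u,i}\in V$ ($1\le u\le\mathfrak m+1$, $1\le i\le k_u$) be such that for every $u_0\in\{0,\dots,\mathfrak m-1\}$ the elements $N^\alpha l_{\beta,\gamma}$ with $\alpha\in\{u_0,\dots,\mathfrak m-1\}$, $\beta\in\{\alpha+2,\dots,\mathfrak m+1\}$, $\gamma\in\{1,\dots,k_\beta\}$ form a $\mathbb C_\infty$-basis of $N^{u_0}V$. Write $\hat l_u=(l_{u,1},\dots,l_{u,k_u})^t$ (column). For $u\in\{1,\dots,\mathfrak m\}$, $z\in\{u-1,\dots,\mathfrak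 m-1\}$, $y\in\{z+2,\dots,\mathfrak m+1\}$ let $S_{u,u-1,y,z}$ be the unique $k_u\times k_y$ matrices over $\mathbb C_\infty$ with $N^{u-1}\hat l_u=-\sum_{z=u-1}^{\mathfrak m-1}\sum_{y=z+2}^{\mathfrak m+1}S_{u,u-1,y,z}N^z\hat l_y$. For $v\in\{0,\dots,\mathfrak m-1\}$, $u\in\{1,\dots,\mathfrak m+1\}$, $z\in\{v,\dots,\mathfrak m-1\}$, $y\in\{z+2,\dots,\mathfrak m+1\}$ let $P_{u,v,y,z}$ be the unique $k_u\times k_y$ matrices with $N^v\hat l_u=-\sum_{z=v}^{\mathfrak m-1}\sum_{y=z+2}^{\mathfrak m+1}P_{u,v,y,z}N^z\hat l_y$. (Thus $P_{u,u-1,y,z}=S_{u,u-1,y,z}$, and for $v<u-1$, $P_{u,v,u,v}=-I$ and $P_{u,v,y,z}=0$ for $(y,z)\ne(u,v)$.) -}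

module Defs where

open import Level using (Level; _⊔_)
open import Data.Nat using (ℕ; zero; suc; _+_; _∸_; _≤_; _<_)
open import Data.Fin using (Fin)
open import Data.Product using (_×_; ∃)
open import Relation.Nullary using (¬_)
open import Algebra.Bundles using (CommutativeRing)
open import Algebra.Module.Bundles using (Module)
open import Algebra.Module.Morphism.Structures using (module ModuleMorphisms)

IsField : ∀ {c ℓ} → CommutativeRing c ℓ → Set (c ⊔ ℓ)
IsField R = ¬ (1# ≈ 0#) × (∀ x → ¬ (x ≈ 0#) → ∃ λ y → x * y ≈ 1#)
  where open CommutativeRing R

module Sums {a} {A : Set a} (ε : A) (_∙_ : A → A → A) where
  sumFrom : ℕ → ℕ → (ℕ → A) → A
  sumFrom lo zero    f = ε
  sumFrom lo (suc c) f = f lo ∙ sumFrom (suc lo) c f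

  -- Σ_{i=lo}^{hi} f i  (empty if hi < lo)
  sumRange : ℕ → ℕ → (ℕ → A) → A
  sumRange lo hi f = sumFrom lo (suc hi ∸ lo) f

  sumFin : (n : ℕ) → (Fin n → A) → A
  sumFin zero    f = ε
  sumFin (suc n) f = f Fin.zero ∙ sumFin n (λ i → f (Fin.suc i))
    where import Data.Fin as Fin

pow : ∀ {a} {A : Set a} → ℕ → (A → A) → A → A
pow zero    N v = v
pow (suc n) N v = N (pow n N v)

module Setting {c ℓ m ℓm} (R : CommutativeRing c ℓ) (M : Module R m ℓm) where
  open CommutativeRing R public
    using (Carrier; _≈_; 0#; 1#)
    renaming (_+_ to _+ᶠ_; _*_ to _*ᶠ_; _-_ to _-ᶠ_)
  open Module M public
    using (Carrierᴹ; _≈ᴹ_; _+ᴹ_; 0ᴹ; -ᴹ_; _*ₗ_; rawModule)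

  open Sums 0# _+ᶠ_ public using ()
    renaming (sumRange to Σ[_⋯_]; sumFin to ΣFin)
  open Sums 0ᴹ _+ᴹ_ public using ()
    renaming (sumRange to Σᴹ[_⋯_]; sumFin to ΣᴹFin)

  IsLinear : (Carrierᴹ → Carrierᴹ) → Set _
  IsLinear N = ModuleMorphisms.IsModuleHomomorphism rawModule rawModule N

  module _ (N : Carrierᴹ → Carrierᴹ) (𝔪 : ℕ) (k : ℕ → ℕ)
           (l : (u : ℕ) → Fin (k u) → Carrierᴹ) where

    comb : ℕ → ((α β : ℕ) → Fin (k β) → Carrier) → Carrierᴹ
    comb u0 coef =
      Σᴹ[ u0 ⋯ 𝔪 ∸ 1 ] λ α → Σᴹ[ α + 2 ⋯ suc 𝔪 ] λ β →
        ΣᴹFin (k β) λ γ → coef α β γ *ₗ pow α N (l β γ)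

    LinIndep : ℕ → Set _
    LinIndep u0 = ∀ coef → comb u0 coef ≈ᴹ 0ᴹ →
      ∀ α β (γ : Fin (k β)) → u0 ≤ α → α ≤ 𝔪 ∸ 1 → α + 2 ≤ β → β ≤ suc 𝔪 →
      coef α β γ ≈ 0#

    Spans : ℕ → Set _
    Spans u0 = ∀ w → ∃ λ coef → pow u0 N w ≈ᴹ comb u0 coef

    IsBasisOfImage : ℕ → Set _
    IsBasisOfImage u0 = LinIndep u0 × Spans u0

    -- Entry (a) of the vector identity
    --   N^v l̂_u = - Σ_{z=v}^{𝔪-1} Σ_{y=z+2}^{𝔪+1} Q_{y,z} N^z l̂_y,
    -- where Q y z : k_u × k_y matrix (as a function Fin (k u) → Fin (k y) → F).
    Expansion : (u v : ℕ) → ((y z : ℕ) → Fin (k u) → Fin (k y) → Carrier) → Set _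
    Expansion u v Q = ∀ (a : Fin (k u)) →
      pow v N (l u a) ≈ᴹ -ᴹ (Σᴹ[ v ⋯ 𝔪 ∸ 1 ] λ z → Σᴹ[ z + 2 ⋯ suc 𝔪 ] λ y →
                                ΣᴹFin (k y) λ b → Q y z a b *ₗ pow z N (l y b))

{-# OPTIONS --safe #-}
-- Apply N^d, with v = 𝔪 - j and d = v - (i - 2), to the S-relation
-- N^{i-2} l̂_{i-1} = - Σ S N^z l̂_y.  Each N^{d+z} l_{y,b} has explicit coordinates in the
-- basis of N^v V: it is itself a basis vector when y ≥ d + z + 2, it vanishes when d + z ≥ 𝔪,
-- and otherwise it is minus its P-expansion.  Comparing the resulting expansion of N^v l̂_{i-1}
-- with its P-expansion, linear independence identifies P_{i-1,v,ψ,ξ} with the (ξ, ψ)-coordinate.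
-- There the summand z = i - 2 + β contributes - Σ_α S P for β ≤ ξ + j - 𝔪 and nothing for larger
-- β, while the basis vectors contribute the single entry S_{i-1,i-2,ψ,i-2+ξ+j-𝔪}.
module Submission where

open import Defs
open import Level using (Level)
open import Data.Bool using (_∧_; if_then_else_)
open import Data.Nat using (ℕ; zero; suc; _+_; _∸_; _≤_; _<_; z≤n; s≤s; _≟_; _≤?_; _<?_)
open import Data.Nat.Properties
open import Data.Fin using (Fin; toℕ)
import Data.Fin as F
import Data.Fin.Properties as F
open import Data.Empty using (⊥-elim)
open import Data.Product using (proj₁)
open import Function using (_∘_)
open import Relation.Nullary using (yes; no; ¬_; does)
open import Relation.Nullary.Decidable using (dec-true; dec-false)
open import Relation.Binary.PropositionalEquality as P using (_≡_; _≢_)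
import Relation.Binary.Reasoning.Setoid as SetoidReasoning
open import Algebra.Bundles using (CommutativeMonoid; CommutativeRing)
open import Algebra.Module.Bundles using (Module)
open import Algebra.Module.Morphism.Structures using (module ModuleMorphisms)

private
  tail-bound : ∀ {lo c t} → t < suc lo + c → t < lo + suc c
  tail-bound {lo} {c} {t} = P.subst (t <_) (P.sym (+-suc lo c))

  head-bound : ∀ lo c → lo < lo + suc c
  head-bound lo c = tail-bound (s≤s (m≤m+n lo c))

  range-bound : ∀ {lo hi t} → lo ≤ t → t < lo + (suc hi ∸ lo) → t ≤ hi
  range-bound {lo} {hi} {t} lo≤t t<
    with lo ≤? suc hi
  ... | yes lo≤ = ≤-pred (P.subst (t <_) (m+[n∸m]≡n lo≤) t<)
  ... | no lo≰ = ⊥-elim (<⇒≱ (P.subst (t <_) empty t<) lo≤t)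
    where
      empty : lo + (suc hi ∸ lo) ≡ lo
      empty = P.trans (P.cong (lo +_) (m≤n⇒m∸n≡0 (<⇒≤ (≰⇒> lo≰)))) (+-identityʳ lo)

  in-range : ∀ {lo hi t} → lo ≤ t → t ≤ hi → t < lo + (suc hi ∸ lo)
  in-range {lo} {hi} {t} lo≤t t≤hi =
    P.subst (t <_) (P.sym (m+[n∸m]≡n (≤-trans lo≤t (m≤n⇒m≤1+n t≤hi)))) (s≤s t≤hi)

record BasisIndex (𝔪 u0 α β : ℕ) : Set where
  constructor index
  field
    lower : u0 ≤ α
    upper : α ≤ 𝔪 ∸ 1
    gap   : α + 2 ≤ β
    top   : β ≤ suc 𝔪

module FiniteSums {c ℓ} (CM : CommutativeMonoid c ℓ) where
  open CommutativeMonoid CM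
  open Sums ε _∙_
  open import Algebra.Properties.CommutativeSemigroup commutativeSemigroup using (interchange)

  private
    sumFrom-cong : ∀ lo c {f g : ℕ → Carrier} →
      (∀ t → lo ≤ t → t < lo + c → f t ≈ g t) → sumFrom lo c f ≈ sumFrom lo c g
    sumFrom-cong lo zero    f≈g = refl
    sumFrom-cong lo (suc c) f≈g =
      ∙-cong (f≈g lo ≤-refl (head-bound lo c))
             (sumFrom-cong (suc lo) c λ t lo< t< → f≈g t (<⇒≤ lo<) (tail-bound t<))

    sumFrom-ε : ∀ lo c → sumFrom lo c (λ _ → ε) ≈ ε
    sumFrom-ε lo zero    = refl
    sumFrom-ε lo (suc c) = trans (identityˡ _) (sumFrom-ε (suc lo) c)

    sumFrom-∙ : ∀ lo c (f g : ℕ → Carrier) →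
      sumFrom lo c (λ t → f t ∙ g t) ≈ sumFrom lo c f ∙ sumFrom lo c g
    sumFrom-∙ lo zero    f g = sym (identityˡ ε)
    sumFrom-∙ lo (suc c) f g = trans (∙-congˡ (sumFrom-∙ (suc lo) c f g)) (interchange _ _ _ _)

    sumFrom-+ : ∀ lo c₁ c₂ (f : ℕ → Carrier) →
      sumFrom lo (c₁ + c₂) f ≈ sumFrom lo c₁ f ∙ sumFrom (lo + c₁) c₂ f
    sumFrom-+ lo zero c₂ f =
      trans (reflexive (P.cong (λ lo′ → sumFrom lo′ c₂ f) (P.sym (+-identityʳ lo)))) (sym (identityˡ _))
    sumFrom-+ lo (suc c₁) c₂ f = trans (∙-congˡ (sumFrom-+ (suc lo) c₁ c₂ f)) (trans
      (∙-congˡ (∙-congˡ (reflexive (P.cong (λ lo′ → sumFrom lo′ c₂ f) (P.sym (+-suc lo c₁))))))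
      (sym (assoc _ _ _)))

    sumFrom-single : ∀ lo c t₀ {f : ℕ → Carrier} → lo ≤ t₀ → t₀ < lo + c →
      (∀ t → lo ≤ t → t < lo + c → t ≢ t₀ → f t ≈ ε) → sumFrom lo c f ≈ f t₀
    sumFrom-single lo zero t₀ lo≤t₀ t₀< _ = ⊥-elim (<⇒≱ (P.subst (t₀ <_) (+-identityʳ lo) t₀<) lo≤t₀)
    sumFrom-single lo (suc c) t₀ {f} lo≤t₀ t₀< rest with lo ≟ t₀
    ... | yes P.refl = trans (∙-congˡ (trans
            (sumFrom-cong (suc lo) c λ t lo< t< → rest t (<⇒≤ lo<) (tail-bound t<) (>⇒≢ lo<))
            (sumFrom-ε (suc lo) c)))
          (identityʳ _)
    ... | no lo≢t₀ = trans (∙-cong (rest lo ≤-refl (head-bound lo c) lo≢t₀)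
            (sumFrom-single (suc lo) c t₀ (≤∧≢⇒< lo≤t₀ lo≢t₀) (P.subst (t₀ <_) (+-suc lo c) t₀<)
               λ t lo< t< → rest t (<⇒≤ lo<) (tail-bound t<)))
          (identityˡ _)

  sumRange-cong : ∀ lo hi {f g : ℕ → Carrier} →
    (∀ t → lo ≤ t → t ≤ hi → f t ≈ g t) → sumRange lo hi f ≈ sumRange lo hi g
  sumRange-cong lo hi f≈g = sumFrom-cong lo (suc hi ∸ lo) λ t lo≤t t< → f≈g t lo≤t (range-bound lo≤t t<)

  sumRange-zero : ∀ lo hi {f : ℕ → Carrier} →
    (∀ t → lo ≤ t → t ≤ hi → f t ≈ ε) → sumRange lo hi f ≈ ε
  sumRange-zero lo hi f≈ε = trans (sumRange-cong lo hi f≈ε) (sumFrom-ε lo (suc hi ∸ lo))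

  sumRange-∙ : ∀ lo hi (f g : ℕ → Carrier) →
    sumRange lo hi (λ t → f t ∙ g t) ≈ sumRange lo hi f ∙ sumRange lo hi g
  sumRange-∙ lo hi = sumFrom-∙ lo (suc hi ∸ lo)

  private
    sumRange-splitAt : ∀ lo mid hi (f : ℕ → Carrier) → lo ≤ mid → mid ≤ suc hi →
      sumRange lo hi f ≈ sumFrom lo (mid ∸ lo) f ∙ sumRange mid hi f
    sumRange-splitAt lo mid hi f lo≤mid mid≤ = trans
      (reflexive (P.cong (λ c → sumFrom lo c f) count))
      (trans (sumFrom-+ lo (mid ∸ lo) (suc hi ∸ mid) f)
             (∙-congˡ (reflexive (P.cong (λ lo′ → sumFrom lo′ (suc hi ∸ mid) f) (m+[n∸m]≡n lo≤mid)))))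
      where
        count : suc hi ∸ lo ≡ (mid ∸ lo) + (suc hi ∸ mid)
        count = P.trans (P.cong (_∸ lo) (P.sym (m+[n∸m]≡n mid≤))) (+-∸-comm (suc hi ∸ mid) lo≤mid)

  sumRange-split : ∀ lo mid hi (f : ℕ → Carrier) → lo ≤ suc mid → mid ≤ hi →
    sumRange lo hi f ≈ sumRange lo mid f ∙ sumRange (suc mid) hi f
  sumRange-split lo mid hi f lo≤ mid≤hi = sumRange-splitAt lo (suc mid) hi f lo≤ (s≤s mid≤hi)

  sumRange-dropPrefix : ∀ lo mid hi {f : ℕ → Carrier} → lo ≤ mid → mid ≤ suc hi →
    (∀ t → lo ≤ t → t < mid → f t ≈ ε) → sumRange lo hi f ≈ sumRange mid hi f
  sumRange-dropPrefix lo mid hi {f} lo≤mid mid≤ f≈ε = trans (sumRange-splitAt lo mid hi f lo≤mid mid≤)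
    (trans (∙-congʳ (trans (sumFrom-cong lo (mid ∸ lo) prefix≈ε) (sumFrom-ε lo (mid ∸ lo))))
           (identityˡ _))
    where
      prefix≈ε : ∀ t → lo ≤ t → t < lo + (mid ∸ lo) → f t ≈ ε
      prefix≈ε t lo≤t t< = f≈ε t lo≤t (P.subst (t <_) (m+[n∸m]≡n lo≤mid) t<)

  sumRange-single : ∀ lo hi t₀ {f : ℕ → Carrier} → lo ≤ t₀ → t₀ ≤ hi →
    (∀ t → lo ≤ t → t ≤ hi → t ≢ t₀ → f t ≈ ε) → sumRange lo hi f ≈ f t₀
  sumRange-single lo hi t₀ lo≤t₀ t₀≤hi rest =
    sumFrom-single lo (suc hi ∸ lo) t₀ lo≤t₀ (in-range lo≤t₀ t₀≤hi) λ t lo≤t t< →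
      rest t lo≤t (range-bound lo≤t t<)

  sumRange-shift : ∀ n lo hi (f : ℕ → Carrier) →
    sumRange (n + lo) (n + hi) f ≡ sumRange lo hi (λ t → f (n + t))
  sumRange-shift n lo hi f = P.trans (P.cong (λ c → sumFrom (n + lo) c f) count) (shift lo (suc hi ∸ lo))
    where
      count : suc (n + hi) ∸ (n + lo) ≡ suc hi ∸ lo
      count = P.trans (P.cong (_∸ (n + lo)) (P.sym (+-suc n hi))) ([m+n]∸[m+o]≡n∸o n (suc hi) lo)
      shift : ∀ lo c → sumFrom (n + lo) c f ≡ sumFrom lo c (λ t → f (n + t))
      shift lo zero    = P.refl
      shift lo (suc c) = P.cong (f (n + lo) ∙_)
        (P.trans (P.cong (λ lo′ → sumFrom lo′ c f) (P.sym (+-suc n lo))) (shift (suc lo) c))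

  sumFin-cong : ∀ n {f g : Fin n → Carrier} → (∀ i → f i ≈ g i) → sumFin n f ≈ sumFin n g
  sumFin-cong zero    f≈g = refl
  sumFin-cong (suc n) f≈g = ∙-cong (f≈g F.zero) (sumFin-cong n (f≈g ∘ F.suc))

  sumFin-zero : ∀ n {f : Fin n → Carrier} → (∀ i → f i ≈ ε) → sumFin n f ≈ ε
  sumFin-zero zero    f≈ε = refl
  sumFin-zero (suc n) f≈ε = trans (∙-cong (f≈ε F.zero) (sumFin-zero n (f≈ε ∘ F.suc))) (identityˡ ε)

  sumFin-∙ : ∀ n (f g : Fin n → Carrier) →
    sumFin n (λ i → f i ∙ g i) ≈ sumFin n f ∙ sumFin n g
  sumFin-∙ zero    f g = sym (identityˡ ε)
  sumFin-∙ (suc n) f g = trans (∙-congˡ (sumFin-∙ n (f ∘ F.suc) (g ∘ F.suc))) (interchange _ _ _ _)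

  sumFin-single : ∀ n (i₀ : Fin n) {f : Fin n → Carrier} →
    (∀ i → i ≢ i₀ → f i ≈ ε) → sumFin n f ≈ f i₀
  sumFin-single (suc n) F.zero rest =
    trans (∙-congˡ (sumFin-zero n λ i → rest (F.suc i) λ ())) (identityʳ _)
  sumFin-single (suc n) (F.suc i₀) rest =
    trans (∙-congʳ (rest F.zero λ ()))
      (trans (identityˡ _) (sumFin-single n i₀ λ i i≢i₀ → rest (F.suc i) (i≢i₀ ∘ F.suc-injective)))

  module _ (h : Carrier → Carrier) (h-cong : ∀ {x y} → x ≈ y → h x ≈ h y)
           (h-ε : h ε ≈ ε) (h-∙ : ∀ x y → h (x ∙ y) ≈ h x ∙ h y) where

    private
      sumFrom-hom : ∀ lo c (f : ℕ → Carrier) → h (sumFrom lo c f) ≈ sumFrom lo c (h ∘ f)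
      sumFrom-hom lo zero    f = h-ε
      sumFrom-hom lo (suc c) f = trans (h-∙ _ _) (∙-congˡ (sumFrom-hom (suc lo) c f))

    sumRange-hom : ∀ lo hi (f : ℕ → Carrier) → h (sumRange lo hi f) ≈ sumRange lo hi (h ∘ f)
    sumRange-hom lo hi = sumFrom-hom lo (suc hi ∸ lo)

    sumFin-hom : ∀ n (f : Fin n → Carrier) → h (sumFin n f) ≈ sumFin n (h ∘ f)
    sumFin-hom zero    f = h-ε
    sumFin-hom (suc n) f = trans (h-∙ _ _) (∙-congˡ (sumFin-hom n (f ∘ F.suc)))

  module TripleSums (𝔪 : ℕ) (k : ℕ → ℕ) where

    Family : Set c
    Family = (α β : ℕ) → Fin (k β) → Carrier

    Σ³ : ℕ → Family → Carrier
    Σ³ u0 F = sumRange u0 (𝔪 ∸ 1) λ α → sumRange (α + 2) (suc 𝔪) λ β → sumFin (k β) (F α β)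

    Σ³-cong : ∀ u0 {F G : Family} →
      (∀ α β γ → BasisIndex 𝔪 u0 α β → F α β γ ≈ G α β γ) → Σ³ u0 F ≈ Σ³ u0 G
    Σ³-cong u0 F≈G = sumRange-cong u0 (𝔪 ∸ 1) λ α u0≤α α≤ →
      sumRange-cong (α + 2) (suc 𝔪) λ β gap top → sumFin-cong (k β) λ γ →
        F≈G α β γ (index u0≤α α≤ gap top)

    Σ³-zero : ∀ u0 {F : Family} → (∀ α β γ → BasisIndex 𝔪 u0 α β → F α β γ ≈ ε) → Σ³ u0 F ≈ ε
    Σ³-zero u0 F≈ε = sumRange-zero u0 (𝔪 ∸ 1) λ α u0≤α α≤ →
      sumRange-zero (α + 2) (suc 𝔪) λ β gap top → sumFin-zero (k β) λ γ →
        F≈ε α β γ (index u0≤α α≤ gap top)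

    Σ³-∙ : ∀ u0 (F G : Family) → Σ³ u0 (λ α β γ → F α β γ ∙ G α β γ) ≈ Σ³ u0 F ∙ Σ³ u0 G
    Σ³-∙ u0 F G = trans
      (sumRange-cong u0 (𝔪 ∸ 1) λ α _ _ → trans
        (sumRange-cong (α + 2) (suc 𝔪) λ β _ _ → sumFin-∙ (k β) (F α β) (G α β))
        (sumRange-∙ (α + 2) (suc 𝔪) _ _))
      (sumRange-∙ u0 (𝔪 ∸ 1) _ _)

    Σ³-single : ∀ u0 e y (b : Fin (k y)) {F : Family} → BasisIndex 𝔪 u0 e y →
      (∀ α β γ → BasisIndex 𝔪 u0 α β → α ≢ e → F α β γ ≈ ε) →
      (∀ β γ → BasisIndex 𝔪 u0 e β → β ≢ y → F e β γ ≈ ε) →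
      (∀ γ → γ ≢ b → F e y γ ≈ ε) →
      Σ³ u0 F ≈ F e y b
    Σ³-single u0 e y b (index u0≤e e≤ gap top) off-α off-β off-γ = trans
      (sumRange-single u0 (𝔪 ∸ 1) e u0≤e e≤ λ α u0≤α α≤ α≢e →
        sumRange-zero (α + 2) (suc 𝔪) λ β gap′ top′ → sumFin-zero (k β) λ γ →
          off-α α β γ (index u0≤α α≤ gap′ top′) α≢e)
      (trans (sumRange-single (e + 2) (suc 𝔪) y gap top λ β gap′ top′ β≢y →
          sumFin-zero (k β) λ γ → off-β β γ (index u0≤e e≤ gap′ top′) β≢y)
        (sumFin-single (k y) b off-γ))

    Σ³-dropPrefix : ∀ u0 e {F : Family} → u0 ≤ e → e ≤ 𝔪 →
      (∀ α β γ → BasisIndex 𝔪 u0 α β → α < e → F α β γ ≈ ε) → Σ³ u0 F ≈ Σ³ e F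
    Σ³-dropPrefix u0 e u0≤e e≤𝔪 F≈ε =
      sumRange-dropPrefix u0 e (𝔪 ∸ 1) u0≤e (≤-trans e≤𝔪 (m≤n+m∸n 𝔪 1)) λ α u0≤α α<e →
        sumRange-zero (α + 2) (suc 𝔪) λ β gap top → sumFin-zero (k β) λ γ →
          F≈ε α β γ (index u0≤α (m+n≤o⇒m≤o∸n α (≤-trans (P.subst (_≤ e) (+-comm 1 α) α<e) e≤𝔪)) gap top) α<e

    module _ (h : Carrier → Carrier) (h-cong : ∀ {x y} → x ≈ y → h x ≈ h y)
             (h-ε : h ε ≈ ε) (h-∙ : ∀ x y → h (x ∙ y) ≈ h x ∙ h y) where

      Σ³-hom : ∀ u0 (F : Family) → h (Σ³ u0 F) ≈ Σ³ u0 (λ α β γ → h (F α β γ))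
      Σ³-hom u0 F = trans (sumRange-hom h h-cong h-ε h-∙ u0 (𝔪 ∸ 1) _)
        (sumRange-cong u0 (𝔪 ∸ 1) λ α _ _ → trans (sumRange-hom h h-cong h-ε h-∙ (α + 2) (suc 𝔪) _)
          (sumRange-cong (α + 2) (suc 𝔪) λ β _ _ → sumFin-hom h h-cong h-ε h-∙ (k β) (F α β)))

module LinearCombinations {c ℓ m ℓm} (R : CommutativeRing c ℓ) (M : Module R m ℓm) where
  open Setting R M
  private
    module R = CommutativeRing R
    module M = Module M
    module ΣR = FiniteSums R.+-commutativeMonoid
    module ΣM = FiniteSums M.+ᴹ-commutativeMonoid
  open import Algebra.Properties.AbelianGroup M.+ᴹ-abelianGroup as Mᴾ using ()
  open import Algebra.Properties.AbelianGroup R.+-abelianGroup as Rᴾ using ()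
  open import Algebra.Properties.Ring R.ring using (-‿distribʳ-*)

  *ₗ-negˡ : ∀ s x → (R.- s) *ₗ x ≈ᴹ -ᴹ (s *ₗ x)
  *ₗ-negˡ s x = Mᴾ.inverseʳ-unique (s *ₗ x) ((R.- s) *ₗ x)
    (M.≈ᴹ-trans (M.≈ᴹ-sym (M.*ₗ-distribʳ x s (R.- s)))
      (M.≈ᴹ-trans (M.*ₗ-cong (R.-‿inverseʳ s) M.≈ᴹ-refl) (M.*ₗ-zeroˡ x)))

  neg-sumRange : ∀ lo hi (f : ℕ → Carrier) → R.- (Σ[ lo ⋯ hi ] f) ≈ Σ[ lo ⋯ hi ] (R.-_ ∘ f)
  neg-sumRange = ΣR.sumRange-hom R.-_ R.-‿cong Rᴾ.ε⁻¹≈ε (λ x y → R.sym (Rᴾ.⁻¹-∙-comm x y))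

  neg-sumFin : ∀ n (f : Fin n → Carrier) → R.- ΣFin n f ≈ ΣFin n (R.-_ ∘ f)
  neg-sumFin = ΣR.sumFin-hom R.-_ R.-‿cong Rᴾ.ε⁻¹≈ε (λ x y → R.sym (Rᴾ.⁻¹-∙-comm x y))

  module Powers (N : Carrierᴹ → Carrierᴹ) (N-linear : IsLinear N) where
    private module N = ModuleMorphisms.IsModuleHomomorphism N-linear

    pow-cong : ∀ n {x y} → x ≈ᴹ y → pow n N x ≈ᴹ pow n N y
    pow-cong zero    x≈y = x≈y
    pow-cong (suc n) x≈y = N.⟦⟧-cong (pow-cong n x≈y)

    pow-+ᴹ : ∀ n x y → pow n N (x +ᴹ y) ≈ᴹ pow n N x +ᴹ pow n N y
    pow-+ᴹ zero    x y = M.≈ᴹ-refl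
    pow-+ᴹ (suc n) x y = M.≈ᴹ-trans (N.⟦⟧-cong (pow-+ᴹ n x y)) (N.+ᴹ-homo _ _)

    pow-0ᴹ : ∀ n → pow n N 0ᴹ ≈ᴹ 0ᴹ
    pow-0ᴹ zero    = M.≈ᴹ-refl
    pow-0ᴹ (suc n) = M.≈ᴹ-trans (N.⟦⟧-cong (pow-0ᴹ n)) N.0ᴹ-homo

    pow--ᴹ : ∀ n x → pow n N (-ᴹ x) ≈ᴹ -ᴹ pow n N x
    pow--ᴹ zero    x = M.≈ᴹ-refl
    pow--ᴹ (suc n) x = M.≈ᴹ-trans (N.⟦⟧-cong (pow--ᴹ n x)) (N.-ᴹ-homo _)

    pow-*ₗ : ∀ n s x → pow n N (s *ₗ x) ≈ᴹ s *ₗ pow n N x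
    pow-*ₗ zero    s x = M.≈ᴹ-refl
    pow-*ₗ (suc n) s x = M.≈ᴹ-trans (N.⟦⟧-cong (pow-*ₗ n s x)) (N.*ₗ-homo _ _)

    pow-+ : ∀ a b x → pow (a + b) N x ≡ pow a N (pow b N x)
    pow-+ zero    b x = P.refl
    pow-+ (suc a) b x = P.cong N (pow-+ a b x)

    pow-nilpotent : ∀ 𝔪 → (∀ w → pow 𝔪 N w ≈ᴹ 0ᴹ) → ∀ e x → 𝔪 ≤ e → pow e N x ≈ᴹ 0ᴹ
    pow-nilpotent 𝔪 N^𝔪≈0 e x 𝔪≤e = M.≈ᴹ-trans
      (M.≈ᴹ-reflexive (P.trans (P.cong (λ n → pow n N x) (P.sym (m∸n+n≡m 𝔪≤e))) (pow-+ (e ∸ 𝔪) 𝔪 x)))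
      (M.≈ᴹ-trans (pow-cong (e ∸ 𝔪) (N^𝔪≈0 x)) (pow-0ᴹ (e ∸ 𝔪)))

  module Coordinates (N : Carrierᴹ → Carrierᴹ) (N-linear : IsLinear N) (𝔪 : ℕ) (k : ℕ → ℕ)
                     (l : (u : ℕ) → Fin (k u) → Carrierᴹ) where
    open Powers N N-linear
    open ΣR.TripleSums 𝔪 k public using (Σ³) renaming (Family to Coefficients)
    private
      module Σ³ᴹ = ΣM.TripleSums 𝔪 k

    combination : ℕ → Coefficients → Carrierᴹ
    combination = comb N 𝔪 k l

    expansionCoefficients : ∀ {u} → ((y z : ℕ) → Fin (k u) → Fin (k y) → Carrier) →
                            Fin (k u) → Coefficients
    expansionCoefficients Q a α β γ = Q β α a γ

    comb-expansion : ∀ {u v Q} → Expansion N 𝔪 k l u v Q →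
      ∀ a → combination v (expansionCoefficients Q a) ≈ᴹ -ᴹ pow v N (l u a)
    comb-expansion expansion a =
      M.≈ᴹ-trans (M.≈ᴹ-sym (Mᴾ.⁻¹-involutive _)) (M.-ᴹ‿cong (M.≈ᴹ-sym (expansion a)))

    comb-cong : ∀ u0 {f g : Coefficients} → (∀ α β γ → BasisIndex 𝔪 u0 α β → f α β γ ≈ g α β γ) →
      combination u0 f ≈ᴹ combination u0 g
    comb-cong u0 f≈g = Σ³ᴹ.Σ³-cong u0 λ α β γ i → M.*ₗ-cong (f≈g α β γ i) M.≈ᴹ-refl

    comb-0 : ∀ u0 → combination u0 (λ _ _ _ → 0#) ≈ᴹ 0ᴹ
    comb-0 u0 = Σ³ᴹ.Σ³-zero u0 λ α β γ _ → M.*ₗ-zeroˡ _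

    comb-+ : ∀ u0 (f g : Coefficients) →
      combination u0 (λ α β γ → f α β γ +ᶠ g α β γ) ≈ᴹ combination u0 f +ᴹ combination u0 g
    comb-+ u0 f g = M.≈ᴹ-trans (Σ³ᴹ.Σ³-cong u0 λ α β γ _ → M.*ₗ-distribʳ _ _ _) (Σ³ᴹ.Σ³-∙ u0 _ _)

    comb-neg : ∀ u0 (f : Coefficients) →
      combination u0 (λ α β γ → R.- f α β γ) ≈ᴹ -ᴹ combination u0 f
    comb-neg u0 f = M.≈ᴹ-trans (Σ³ᴹ.Σ³-cong u0 λ α β γ _ → *ₗ-negˡ _ _) (M.≈ᴹ-sym
      (Σ³ᴹ.Σ³-hom -ᴹ_ M.-ᴹ‿cong Mᴾ.ε⁻¹≈ε (λ x y → M.≈ᴹ-sym (Mᴾ.⁻¹-∙-comm x y)) u0 _))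

    comb-*ₗ : ∀ u0 s (f : Coefficients) →
      combination u0 (λ α β γ → s *ᶠ f α β γ) ≈ᴹ s *ₗ combination u0 f
    comb-*ₗ u0 s f = M.≈ᴹ-trans (Σ³ᴹ.Σ³-cong u0 λ α β γ _ → M.*ₗ-assoc _ _ _) (M.≈ᴹ-sym
      (Σ³ᴹ.Σ³-hom (s *ₗ_) (M.*ₗ-cong R.refl) (M.*ₗ-zeroʳ s) (M.*ₗ-distribˡ s) u0 _))

    private
      comb-sumFrom : ∀ u0 lo n (F : ℕ → Coefficients) →
        combination u0 (λ α β γ → Sums.sumFrom 0# _+ᶠ_ lo n λ t → F t α β γ)
          ≈ᴹ Sums.sumFrom 0ᴹ _+ᴹ_ lo n (λ t → combination u0 (F t))
      comb-sumFrom u0 lo zero    F = comb-0 u0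
      comb-sumFrom u0 lo (suc n) F = M.≈ᴹ-trans (comb-+ u0 _ _) (M.+ᴹ-congˡ (comb-sumFrom u0 (suc lo) n F))

      comb-sumFin : ∀ u0 n (F : Fin n → Coefficients) →
        combination u0 (λ α β γ → ΣFin n λ t → F t α β γ) ≈ᴹ ΣᴹFin n (λ t → combination u0 (F t))
      comb-sumFin u0 zero    F = comb-0 u0
      comb-sumFin u0 (suc n) F = M.≈ᴹ-trans (comb-+ u0 _ _) (M.+ᴹ-congˡ (comb-sumFin u0 n (F ∘ F.suc)))

    comb-Σ³ : ∀ u0 z0 (G : (z y : ℕ) → Fin (k y) → Coefficients) →
      combination u0 (λ α β γ → Σ³ z0 λ z y b → G z y b α β γ)
        ≈ᴹ Σ³ᴹ.Σ³ z0 (λ z y b → combination u0 (G z y b))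
    comb-Σ³ u0 z0 G = M.≈ᴹ-trans (comb-sumFrom u0 z0 (suc (𝔪 ∸ 1) ∸ z0) _) (ΣM.sumRange-cong z0 (𝔪 ∸ 1) λ z _ _ →
      M.≈ᴹ-trans (comb-sumFrom u0 (z + 2) (suc (suc 𝔪) ∸ (z + 2)) _) (ΣM.sumRange-cong (z + 2) (suc 𝔪) λ y _ _ →
        comb-sumFin u0 (k y) (G z y)))

    comb-injective : ∀ u0 → LinIndep N 𝔪 k l u0 → ∀ {f g : Coefficients} →
      combination u0 f ≈ᴹ combination u0 g → ∀ α β γ → BasisIndex 𝔪 u0 α β → f α β γ ≈ g α β γ
    comb-injective u0 independent {f} {g} f≡g α β γ (index u0≤α α≤ gap top) =
      Rᴾ.x∙y⁻¹≈ε⇒x≈y _ _ (independent (λ α β γ → f α β γ -ᶠ g α β γ) difference≈0 α β γ u0≤α α≤ gap top)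
      where
        difference≈0 : combination u0 (λ α β γ → f α β γ -ᶠ g α β γ) ≈ᴹ 0ᴹ
        difference≈0 = M.≈ᴹ-trans (comb-+ u0 f _)
          (M.≈ᴹ-trans (M.+ᴹ-congˡ (comb-neg u0 g)) (Mᴾ.x≈y⇒x∙y⁻¹≈ε f≡g))

    unit : ℕ → (y : ℕ) → Fin (k y) → Coefficients
    unit e y b α β γ = if does (α ≟ e) ∧ does (β ≟ y) ∧ does (toℕ γ ≟ toℕ b) then 1# else 0#

    unit-diagonal : ∀ e y b → unit e y b e y b ≡ 1#
    unit-diagonal e y b
      rewrite dec-true (e ≟ e) P.refl | dec-true (y ≟ y) P.refl | dec-true (toℕ b ≟ toℕ b) P.refl = P.refl

    unit-offᵅ : ∀ e y b α β γ → α ≢ e → unit e y b α β γ ≡ 0#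
    unit-offᵅ e y b α β γ α≢e rewrite dec-false (α ≟ e) α≢e = P.refl

    unit-offᵝ : ∀ e y b β γ → β ≢ y → unit e y b e β γ ≡ 0#
    unit-offᵝ e y b β γ β≢y rewrite dec-true (e ≟ e) P.refl | dec-false (β ≟ y) β≢y = P.refl

    unit-offᵞ : ∀ e y b γ → γ ≢ b → unit e y b e y γ ≡ 0#
    unit-offᵞ e y b γ γ≢b
      rewrite dec-true (e ≟ e) P.refl | dec-true (y ≟ y) P.refl
            | dec-false (toℕ γ ≟ toℕ b) (γ≢b ∘ F.toℕ-injective) = P.refl

    gap⇒≤𝔪∸1 : ∀ {e y} → e + 2 ≤ y → y ≤ suc 𝔪 → e ≤ 𝔪 ∸ 1
    gap⇒≤𝔪∸1 {e} gap top = m+n≤o⇒m≤o∸n e (≤-pred (P.subst (_≤ suc 𝔪) (+-suc e 1) (≤-trans gap top)))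

    gap⇒<𝔪 : ∀ {e y} → e + 2 ≤ y → y ≤ suc 𝔪 → e < 𝔪
    gap⇒<𝔪 {e} gap top = ≤-pred (P.subst (_≤ suc 𝔪) (+-comm e 2) (≤-trans gap top))

    comb-unit : ∀ u0 e y b → u0 ≤ e → e + 2 ≤ y → y ≤ suc 𝔪 →
      combination u0 (unit e y b) ≈ᴹ pow e N (l y b)
    comb-unit u0 e y b u0≤e gap top = M.≈ᴹ-trans
      (Σ³ᴹ.Σ³-single u0 e y b (index u0≤e (gap⇒≤𝔪∸1 gap top) gap top)
        (λ α β γ _ α≢e → vanish (unit-offᵅ e y b α β γ α≢e))
        (λ β γ _ β≢y → vanish (unit-offᵝ e y b β γ β≢y))
        (λ γ γ≢b → vanish (unit-offᵞ e y b γ γ≢b)))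
      (M.≈ᴹ-trans (M.*ₗ-cong (R.reflexive (unit-diagonal e y b)) M.≈ᴹ-refl) (M.*ₗ-identityˡ _))
      where
        vanish : ∀ {s x} → s ≡ 0# → s *ₗ x ≈ᴹ 0ᴹ
        vanish s≡0 = M.≈ᴹ-trans (M.*ₗ-cong (R.reflexive s≡0) M.≈ᴹ-refl) (M.*ₗ-zeroˡ _)

    module _ (P : (u v y z : ℕ) → Fin (k u) → Fin (k y) → Carrier) where

      -- Coordinates of N^e l_{y,b} in the basis of N^v V, valid for every v ≤ e.  The P-expansion
      -- only involves α ≥ e; below e the entries of P are junk and are replaced by 0.
      coordinates : ℕ → (y : ℕ) → Fin (k y) → Coefficients
      coordinates e y b α β γ =
        if does (e + 2 ≤? y) then unit e y b α β γ
        else if does (α <? e) then 0#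
        else R.- P y e β α b γ

      coordinates-basis : ∀ e y b α β γ → e + 2 ≤ y → coordinates e y b α β γ ≡ unit e y b α β γ
      coordinates-basis e y b α β γ gap rewrite dec-true (e + 2 ≤? y) gap = P.refl

      coordinates-below : ∀ e y b α β γ → α < e → coordinates e y b α β γ ≡ 0#
      coordinates-below e y b α β γ α<e with e + 2 ≤? y
      ... | yes gap = P.trans (coordinates-basis e y b α β γ gap) (unit-offᵅ e y b α β γ (<⇒≢ α<e))
      ... | no no-gap rewrite dec-false (e + 2 ≤? y) no-gap | dec-true (α <? e) α<e = P.refl

      coordinates-expansion : ∀ e y b α β γ → ¬ e + 2 ≤ y → e ≤ α →
        coordinates e y b α β γ ≡ R.- P y e β α b γ
      coordinates-expansion e y b α β γ no-gap e≤α
        rewrite dec-false (e + 2 ≤? y) no-gap | dec-false (α <? e) (≤⇒≯ e≤α) = P.refl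

      module _ (N^𝔪≈0 : ∀ w → pow 𝔪 N w ≈ᴹ 0ᴹ)
               (P-expansion : ∀ y e → e < 𝔪 → 1 ≤ y → y ≤ suc 𝔪 → Expansion N 𝔪 k l y e (P y e)) where

        comb-coordinates : ∀ v e y b → v ≤ e → 1 ≤ y → y ≤ suc 𝔪 →
          combination v (coordinates e y b) ≈ᴹ pow e N (l y b)
        comb-coordinates v e y b v≤e 1≤y y≤ with e + 2 ≤? y | e <? 𝔪
        ... | yes gap | _ = M.≈ᴹ-trans
              (comb-cong v λ α β γ _ → R.reflexive (coordinates-basis e y b α β γ gap))
              (comb-unit v e y b v≤e gap y≤)
        ... | no no-gap | no e≮𝔪 = M.≈ᴹ-trans
              (comb-cong v λ α β γ (index _ _ gap top) → R.reflexive
                (coordinates-below e y b α β γ (<-≤-trans (gap⇒<𝔪 gap top) (≮⇒≥ e≮𝔪))))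
              (M.≈ᴹ-trans (comb-0 v) (M.≈ᴹ-sym (pow-nilpotent 𝔪 N^𝔪≈0 e (l y b) (≮⇒≥ e≮𝔪))))
        ... | no no-gap | yes e<𝔪 = begin
          combination v (coordinates e y b)
            ≈⟨ Σ³ᴹ.Σ³-dropPrefix v e v≤e (<⇒≤ e<𝔪) (λ α β γ _ α<e →
                 M.≈ᴹ-trans (M.*ₗ-cong (R.reflexive (coordinates-below e y b α β γ α<e)) M.≈ᴹ-refl)
                            (M.*ₗ-zeroˡ _)) ⟩
          combination e (coordinates e y b)
            ≈⟨ comb-cong e (λ α β γ i →
                 R.reflexive (coordinates-expansion e y b α β γ no-gap (BasisIndex.lower i))) ⟩
          combination e (λ α β γ → R.- expansionCoefficients (P y e) b α β γ)
            ≈⟨ comb-neg e _ ⟩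
          -ᴹ combination e (expansionCoefficients (P y e) b)
            ≈⟨ M.-ᴹ‿cong (comb-expansion {y} {e} (P-expansion y e e<𝔪 1≤y y≤) b) ⟩
          -ᴹ -ᴹ pow e N (l y b)
            ≈⟨ Mᴾ.⁻¹-involutive _ ⟩
          pow e N (l y b) ∎
          where open SetoidReasoning M.≈ᴹ-setoid

        pushforward : ∀ u u0 v d {Q} → Expansion N 𝔪 k l u u0 Q → d + u0 ≡ v → ∀ a →
          combination v (λ α β γ → Σ³ u0 λ z y b → Q y z a b *ᶠ coordinates (d + z) y b α β γ)
            ≈ᴹ -ᴹ pow v N (l u a)
        pushforward u u0 v d {Q} expansion d+u0≡v a = begin
          combination v (λ α β γ → Σ³ u0 λ z y b → Q y z a b *ᶠ coordinates (d + z) y b α β γ)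
            ≈⟨ comb-Σ³ v u0 _ ⟩
          Σ³ᴹ.Σ³ u0 (λ z y b → combination v (λ α β γ → Q y z a b *ᶠ coordinates (d + z) y b α β γ))
            ≈⟨ Σ³ᴹ.Σ³-cong u0 (λ z y b (index u0≤z _ gap top) → M.≈ᴹ-trans (comb-*ₗ v _ _)
                 (M.*ₗ-cong R.refl (comb-coordinates v (d + z) y b (v≤d+z u0≤z) (1≤y gap) top))) ⟩
          Σ³ᴹ.Σ³ u0 (λ z y b → Q y z a b *ₗ pow (d + z) N (l y b))
            ≈⟨ Σ³ᴹ.Σ³-cong u0 (λ z y b _ → M.≈ᴹ-trans (M.*ₗ-cong R.refl (M.≈ᴹ-reflexive (pow-+ d z _)))
                 (M.≈ᴹ-sym (pow-*ₗ d _ _))) ⟩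
          Σ³ᴹ.Σ³ u0 (λ z y b → pow d N (Q y z a b *ₗ pow z N (l y b)))
            ≈⟨ Σ³ᴹ.Σ³-hom (pow d N) (pow-cong d) (pow-0ᴹ d) (pow-+ᴹ d) u0 _ ⟨
          pow d N (combination u0 (expansionCoefficients Q a))
            ≈⟨ pow-cong d (comb-expansion {u} {u0} expansion a) ⟩
          pow d N (-ᴹ pow u0 N (l u a))
            ≈⟨ pow--ᴹ d _ ⟩
          -ᴹ pow d N (pow u0 N (l u a))
            ≡⟨ P.cong -ᴹ_ (P.trans (P.sym (pow-+ d u0 _)) (P.cong (λ n → pow n N (l u a)) d+u0≡v)) ⟩
          -ᴹ pow v N (l u a) ∎
          where
            open SetoidReasoning M.≈ᴹ-setoid
            v≤d+z : ∀ {z} → u0 ≤ z → v ≤ d + z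
            v≤d+z u0≤z = P.subst (_≤ _) d+u0≡v (+-monoʳ-≤ d u0≤z)
            1≤y : ∀ {z y} → z + 2 ≤ y → 1 ≤ y
            1≤y {z} gap = ≤-trans (s≤s z≤n) (≤-trans (m≤n+m 2 z) gap)

        coefficient-transfer : ∀ u u0 v d {Q} → LinIndep N 𝔪 k l v →
          Expansion N 𝔪 k l u u0 Q → Expansion N 𝔪 k l u v (P u v) → d + u0 ≡ v →
          ∀ a ξ ψ b → BasisIndex 𝔪 v ξ ψ →
          P u v ψ ξ a b ≈ Σ³ u0 (λ z y b′ → Q y z a b′ *ᶠ coordinates (d + z) y b′ ξ ψ b)
        coefficient-transfer u u0 v d independent Q-expansion Pᵤ-expansion d+u0≡v a ξ ψ b =
          comb-injective v independent
            (M.≈ᴹ-trans (comb-expansion {u} {v} Pᵤ-expansion a)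
                        (M.≈ᴹ-sym (pushforward u u0 v d Q-expansion d+u0≡v a)))
            ξ ψ b

      -- column z e is the (ξ, ψ, b)-coordinate of the z-th column of Σ³ u0 (q * coordinates),
      -- whose exponent is e = d + z.
      module Evaluation (q : (y z : ℕ) → Fin (k y) → Carrier) (ξ ψ : ℕ) (b : Fin (k ψ))
                        (ξ≤ : ξ ≤ 𝔪 ∸ 1) (ξ+2≤ψ : ξ + 2 ≤ ψ) (ψ≤ : ψ ≤ suc 𝔪) where

        column : ℕ → ℕ → Carrier
        column z e = Σ[ z + 2 ⋯ suc 𝔪 ] λ y → ΣFin (k y) λ b′ → q y z b′ *ᶠ coordinates e y b′ ξ ψ b

        expansionPart : ℕ → ℕ → Carrier
        expansionPart z e = Σ[ 2 + z ⋯ suc e ] λ y → ΣFin (k y) λ b′ → q y z b′ *ᶠ P y e ψ ξ b′ b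

        basisPart : ℕ → ℕ → Carrier
        basisPart z e = Σ[ suc (suc e) ⋯ suc 𝔪 ] λ y → ΣFin (k y) λ b′ → q y z b′ *ᶠ unit e y b′ ξ ψ b

        column-vanishes : ∀ z e → ξ < e → column z e ≈ 0#
        column-vanishes z e ξ<e = ΣR.sumRange-zero (z + 2) (suc 𝔪) λ y _ _ → ΣR.sumFin-zero (k y) λ b′ →
          R.trans (R.*-congˡ (R.reflexive (coordinates-below e y b′ ξ ψ b ξ<e))) (R.zeroʳ _)

        column-split : ∀ z e → z ≤ e → e ≤ ξ → column z e ≈ R.- expansionPart z e +ᶠ basisPart z e
        column-split z e z≤e e≤ξ = R.trans
          (ΣR.sumRange-split (z + 2) (suc e) (suc 𝔪) _ (P.subst (_≤ suc (suc e)) (+-comm 2 z) (s≤s (s≤s z≤e)))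
            (s≤s (≤-trans e≤ξ (≤-trans ξ≤ (m∸n≤m 𝔪 1)))))
          (R.+-cong lower (ΣR.sumRange-cong (suc (suc e)) (suc 𝔪) λ y gap _ → ΣR.sumFin-cong (k y) λ b′ →
            R.*-congˡ (R.reflexive (coordinates-basis e y b′ ξ ψ b (P.subst (_≤ y) (+-comm 2 e) gap)))))
          where
            lower : (Σ[ z + 2 ⋯ suc e ] λ y → ΣFin (k y) λ b′ → q y z b′ *ᶠ coordinates e y b′ ξ ψ b)
                      ≈ R.- expansionPart z e
            lower = R.trans
              (R.reflexive (P.cong (λ lo → Σ[ lo ⋯ suc e ] λ y → ΣFin (k y) λ b′ →
                q y z b′ *ᶠ coordinates e y b′ ξ ψ b) (+-comm z 2)))
              (R.trans (ΣR.sumRange-cong (2 + z) (suc e) λ y _ y≤ → R.trans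
                  (ΣR.sumFin-cong (k y) λ b′ → R.trans
                    (R.*-congˡ (R.reflexive (coordinates-expansion e y b′ ξ ψ b (λ gap → 1+n≰n
                      (≤-trans (P.subst (_≤ y) (+-comm e 2) gap) y≤)) e≤ξ)))
                    (R.sym (-‿distribʳ-* _ _)))
                  (R.sym (neg-sumFin (k y) _)))
                (R.sym (neg-sumRange (2 + z) (suc e) _)))

        basisPart-off : ∀ z e → e ≢ ξ → basisPart z e ≈ 0#
        basisPart-off z e e≢ξ = ΣR.sumRange-zero (suc (suc e)) (suc 𝔪) λ y _ _ → ΣR.sumFin-zero (k y) λ b′ →
          R.trans (R.*-congˡ (R.reflexive (unit-offᵅ e y b′ ξ ψ b (e≢ξ ∘ P.sym)))) (R.zeroʳ _)

        basisPart-on : ∀ z → basisPart z ξ ≈ q ψ z b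
        basisPart-on z = R.trans
          (ΣR.sumRange-single (suc (suc ξ)) (suc 𝔪) ψ (P.subst (_≤ ψ) (+-comm ξ 2) ξ+2≤ψ) ψ≤ λ y _ _ y≢ψ →
            ΣR.sumFin-zero (k y) λ b′ →
              R.trans (R.*-congˡ (R.reflexive (unit-offᵝ ξ y b′ ψ b (y≢ψ ∘ P.sym)))) (R.zeroʳ _))
          (R.trans (ΣR.sumFin-single (k ψ) b λ b′ b′≢b →
              R.trans (R.*-congˡ (R.reflexive (unit-offᵞ ξ ψ b′ b (b′≢b ∘ P.sym)))) (R.zeroʳ _))
            (R.trans (R.*-congˡ (R.reflexive (unit-diagonal ξ ψ b))) (R.*-identityʳ _)))

        Σ³-coordinates : ∀ u0 v d t → d + u0 ≡ v → v + t ≡ ξ →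
          Σ³ u0 (λ z y b′ → q y z b′ *ᶠ coordinates (d + z) y b′ ξ ψ b)
            ≈ q ψ (u0 + t) b -ᶠ (Σ[ 0 ⋯ t ] λ β → expansionPart (u0 + β) (v + β))
        Σ³-coordinates u0 v d t d+u0≡v v+t≡ξ = begin
          Σ[ u0 ⋯ 𝔪 ∸ 1 ] (λ z → column z (d + z))
            ≈⟨ ΣR.sumRange-split u0 (u0 + t) (𝔪 ∸ 1) _ (m≤n⇒m≤1+n (m≤m+n u0 t)) (≤-trans u0+t≤ξ ξ≤) ⟩
          Σ[ u0 ⋯ u0 + t ] (λ z → column z (d + z)) +ᶠ Σ[ suc (u0 + t) ⋯ 𝔪 ∸ 1 ] (λ z → column z (d + z))
            ≈⟨ R.trans (R.+-congˡ (ΣR.sumRange-zero (suc (u0 + t)) (𝔪 ∸ 1) λ z u0+t<z _ →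
                 column-vanishes z (d + z) (ξ<d+z u0+t<z))) (R.+-identityʳ _) ⟩
          Σ[ u0 ⋯ u0 + t ] (λ z → column z (d + z))
            ≡⟨ P.trans (P.cong (λ lo → Σ[ lo ⋯ u0 + t ] λ z → column z (d + z)) (P.sym (+-identityʳ u0)))
                       (ΣR.sumRange-shift u0 0 t _) ⟩
          Σ[ 0 ⋯ t ] (λ β → column (u0 + β) (d + (u0 + β)))
            ≈⟨ ΣR.sumRange-cong 0 t (λ β _ β≤t → R.trans (R.reflexive (P.cong (column (u0 + β)) (shift β)))
                 (column-split (u0 + β) (v + β) (+-monoˡ-≤ β u0≤v) (P.subst (v + β ≤_) v+t≡ξ (+-monoʳ-≤ v β≤t)))) ⟩
          Σ[ 0 ⋯ t ] (λ β → R.- expansionPart (u0 + β) (v + β) +ᶠ basisPart (u0 + β) (v + β))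
            ≈⟨ ΣR.sumRange-∙ 0 t _ _ ⟩
          Σ[ 0 ⋯ t ] (λ β → R.- expansionPart (u0 + β) (v + β)) +ᶠ Σ[ 0 ⋯ t ] (λ β → basisPart (u0 + β) (v + β))
            ≈⟨ R.+-cong (R.sym (neg-sumRange 0 t _)) (ΣR.sumRange-single 0 t t z≤n ≤-refl λ β _ _ β≢t →
                 basisPart-off (u0 + β) (v + β)
                   (β≢t ∘ +-cancelˡ-≡ v β t ∘ λ v+β≡ξ → P.trans v+β≡ξ (P.sym v+t≡ξ))) ⟩
          R.- (Σ[ 0 ⋯ t ] λ β → expansionPart (u0 + β) (v + β)) +ᶠ basisPart (u0 + t) (v + t)
            ≈⟨ R.+-congˡ (R.trans (R.reflexive (P.cong (basisPart (u0 + t)) v+t≡ξ)) (basisPart-on (u0 + t))) ⟩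
          R.- (Σ[ 0 ⋯ t ] λ β → expansionPart (u0 + β) (v + β)) +ᶠ q ψ (u0 + t) b
            ≈⟨ R.+-comm _ _ ⟩
          q ψ (u0 + t) b -ᶠ (Σ[ 0 ⋯ t ] λ β → expansionPart (u0 + β) (v + β)) ∎
          where
            open SetoidReasoning R.setoid
            u0≤v : u0 ≤ v
            u0≤v = P.subst (u0 ≤_) d+u0≡v (m≤n+m u0 d)
            shift : ∀ β → d + (u0 + β) ≡ v + β
            shift β = P.trans (P.sym (+-assoc d u0 β)) (P.cong (_+ β) d+u0≡v)
            u0+t≤ξ : u0 + t ≤ ξ
            u0+t≤ξ = P.subst (u0 + t ≤_) v+t≡ξ (+-monoˡ-≤ t u0≤v)
            ξ<d+z : ∀ {z} → u0 + t < z → ξ < d + z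
            ξ<d+z {z} u0+t<z = P.subst₂ _<_ (P.trans (shift t) v+t≡ξ) P.refl (+-monoʳ-< d u0+t<z)

m∸n+[n+o∸m]≡o : ∀ {m n o} → n ≤ m → m ∸ n ≤ o → (m ∸ n) + ((n + o) ∸ m) ≡ o
m∸n+[n+o∸m]≡o {m} {n} {o} n≤m m∸n≤o = begin
  (m ∸ n) + ((n + o) ∸ m)             ≡⟨ P.cong (λ x → (m ∸ n) + ((n + o) ∸ x)) (P.sym (m+[n∸m]≡n n≤m)) ⟩
  (m ∸ n) + ((n + o) ∸ (n + (m ∸ n))) ≡⟨ P.cong ((m ∸ n) +_) ([m+n]∸[m+o]≡n∸o n o (m ∸ n)) ⟩
  (m ∸ n) + (o ∸ (m ∸ n))             ≡⟨ m+[n∸m]≡n m∸n≤o ⟩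
  o                                   ∎
  where open P.≡-Reasoning

lemma3p25 : ∀ {c ℓ m ℓm : Level}
    -- the field (C_∞ in the paper) and the vector space V over it
    (R : CommutativeRing c ℓ) → IsField R → (M : Module R m ℓm) →
    let open Setting R M
    in
    -- N linear and nilpotent with N^𝔪 = 0, 𝔪 ≥ 1
    (N : Carrierᴹ → Carrierᴹ) → IsLinear N →
    (𝔪 : ℕ) → 1 ≤ 𝔪 → (∀ w → pow 𝔪 N w ≈ᴹ 0ᴹ) →
    -- k_u and the elements l_{u,i}
    (k : ℕ → ℕ) → (l : (u : ℕ) → Fin (k u) → Carrierᴹ) →
    -- basis hypothesis for every u0 ∈ {0,…,𝔪-1}
    (∀ u0 → u0 < 𝔪 → IsBasisOfImage N 𝔪 k l u0) →
    -- S u y z = S_{u,u-1,y,z}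
    (S : (u y z : ℕ) → Fin (k u) → Fin (k y) → Carrier) →
    (∀ u → 1 ≤ u → u ≤ 𝔪 → Expansion N 𝔪 k l u (u ∸ 1) (λ y z → S u y z)) →
    -- P u v y z = P_{u,v,y,z}
    (P : (u v y z : ℕ) → Fin (k u) → Fin (k y) → Carrier) →
    (∀ u v → v < 𝔪 → 1 ≤ u → u ≤ suc 𝔪 → Expansion N 𝔪 k l u v (P u v)) →
    -- the claim
    ∀ i j ξ ψ →
    2 ≤ i → i ≤ suc 𝔪 →
    1 ≤ j → j ≤ (𝔪 + 2) ∸ i →
    𝔪 ∸ j ≤ ξ → ξ ≤ 𝔪 ∸ 1 →
    ξ + 2 ≤ ψ → ψ ≤ suc 𝔪 →
    ∀ (a : Fin (k (i ∸ 1))) (b : Fin (k ψ)) →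
    (((Σ[ 0 ⋯ (j + ξ) ∸ 𝔪 ] λ β → Σ[ i + β ⋯ (suc 𝔪 ∸ j) + β ] λ α →
         ΣFin (k α) λ γ →
           S (i ∸ 1) α ((i ∸ 2) + β) a γ *ᶠ P α ((𝔪 ∸ j) + β) ψ ξ γ b)
      -ᶠ S (i ∸ 1) ψ ((i ∸ 2) + ((ξ + j) ∸ 𝔪)) a b)
      +ᶠ P (i ∸ 1) (𝔪 ∸ j) ψ ξ a b) ≈ 0#
lemma3p25 R _ M N N-linear 𝔪 _ N^𝔪≈0 k l basis S S-expansion P P-expansion
          (suc (suc i₀)) (suc j₀) ξ ψ (s≤s (s≤s z≤n)) i≤ (s≤s z≤n) j≤ v≤ξ ξ≤ ξ+2≤ψ ψ≤ a b = begin
  _                                   ≈⟨ R.+-cong (R.+-cong Σ≈A (R.-‿cong S≈s)) (R.trans transfer evaluation) ⟩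
  (A -ᶠ s) +ᶠ (s -ᶠ A)                ≈⟨ R.+-congˡ (R.sym (Rᴾ.⁻¹-anti-homo‿- A s)) ⟩
  (A -ᶠ s) +ᶠ R.- (A -ᶠ s)            ≈⟨ R.-‿inverseʳ _ ⟩
  0#                                  ∎
  where
    open Setting R M
    module R = CommutativeRing R
    open import Algebra.Properties.AbelianGroup R.+-abelianGroup as Rᴾ using ()
    open SetoidReasoning R.setoid
    open LinearCombinations R M
    open Coordinates N N-linear 𝔪 k l
    j = suc j₀
    v = 𝔪 ∸ j
    t = (j + ξ) ∸ 𝔪
    d = v ∸ i₀

    q : (y z : ℕ) → Fin (k y) → Carrier
    q y z = S (suc i₀) y z a
    open Evaluation P q ξ ψ b ξ≤ ξ+2≤ψ ψ≤

    j+i₀≤𝔪 : j + i₀ ≤ 𝔪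
    j+i₀≤𝔪 = m≤o∸n⇒m+n≤o j (<⇒≤ (≤-pred i≤)) (P.subst (λ x → j ≤ x ∸ suc (suc i₀)) (+-comm 𝔪 2) j≤)
    j≤𝔪 : j ≤ 𝔪
    j≤𝔪 = m+n≤o⇒m≤o j j+i₀≤𝔪
    d+i₀≡v : d + i₀ ≡ v
    d+i₀≡v = m∸n+n≡m (m+n≤o⇒m≤o∸n i₀ (P.subst (_≤ 𝔪) (+-comm j i₀) j+i₀≤𝔪))
    v<𝔪 : v < 𝔪
    v<𝔪 = ∸-monoʳ-< (s≤s z≤n) j≤𝔪

    A s : Carrier
    A = Σ[ 0 ⋯ t ] λ β → expansionPart (i₀ + β) (v + β)
    s = q ψ (i₀ + t) b

    Σ≈A : (Σ[ 0 ⋯ t ] λ β → Σ[ 2 + i₀ + β ⋯ (suc 𝔪 ∸ j) + β ] λ α → ΣFin (k α) λ γ →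
             q α (i₀ + β) γ *ᶠ P α (v + β) ψ ξ γ b) ≈ A
    Σ≈A = R.reflexive (P.cong (λ w → Σ[ 0 ⋯ t ] λ β → Σ[ 2 + i₀ + β ⋯ w + β ] λ α → ΣFin (k α) λ γ →
             q α (i₀ + β) γ *ᶠ P α (v + β) ψ ξ γ b) (+-∸-assoc 1 j≤𝔪))
    S≈s : q ψ (i₀ + ((ξ + j) ∸ 𝔪)) b ≈ s
    S≈s = R.reflexive (P.cong (λ x → q ψ (i₀ + (x ∸ 𝔪)) b) (+-comm ξ j))

    transfer : P (suc i₀) v ψ ξ a b ≈ Σ³ i₀ (λ z y b′ → q y z b′ *ᶠ coordinates P (d + z) y b′ ξ ψ b)
    transfer = coefficient-transfer P N^𝔪≈0 P-expansion (suc i₀) i₀ v d (proj₁ (basis v v<𝔪))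
      (S-expansion (suc i₀) (s≤s z≤n) (≤-pred i≤))
      (P-expansion (suc i₀) v v<𝔪 (s≤s z≤n) (m≤n⇒m≤1+n (≤-pred i≤)))
      d+i₀≡v a ξ ψ b (index v≤ξ ξ≤ ξ+2≤ψ ψ≤)
    evaluation : Σ³ i₀ (λ z y b′ → q y z b′ *ᶠ coordinates P (d + z) y b′ ξ ψ b) ≈ s -ᶠ A
    evaluation = Σ³-coordinates i₀ v d t d+i₀≡v (m∸n+[n+o∸m]≡o j≤𝔪 v≤ξ)
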